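{- If $G$ is a block graph, then $\operatorname{mob}(G) = \omega(G)$.
   Context: Graphs are connected and simple; $\omega(G)$ is the clique number. A set $S\subseteq V(G)$ is a general position set if no three distinct vertices of $S$ lie on a common shortest path. Place a robot on each vertex of a general position set $S$; robots move one at a time, a move being legal if the robot moves to an adjacent unoccupied vertex and the new set of occupied vertices is again in general position. $S$ is a mobile general position set if some sequence of legal moves lets every vertex of $G$ be visited by at least one robot. $\operatorname{mob}(G)$ denotes the largest cardinality of a mobile general position set of $G$. -}

module Defs where

open import Data.Nat using (ℕ; zero; suc; _+_; _<_; _≤_)
open import Data.Fin using (Fin)
open import Data.Fin.Subset using (Subset; _∈_; _∉_; _⊆_; ⊤; ∣_∣; inside; outside)
open import Data.Vec using (_[_]≔_)
open import Data.Product using (Σ; ∃; ∃-syntax; _×_; _,_)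
open import Relation.Nullary using (¬_)
open import Relation.Binary.PropositionalEquality using (_≡_; _≢_)

record Graph : Set₁ where
  field
    n       : ℕ
    Adj     : Fin n → Fin n → Set
    sym     : ∀ {u v} → Adj u v → Adj v u
    irrefl  : ∀ {u} → ¬ Adj u u

module _ (G : Graph) where
  open Graph G

  data WalkIn (B : Subset n) : Fin n → Fin n → ℕ → Set where
    here : ∀ {u} → u ∈ B → WalkIn B u u 0
    step : ∀ {u w v k} → u ∈ B → Adj u w → WalkIn B w v k → WalkIn B u v (suc k)

  ConnectedIn : Subset n → Set
  ConnectedIn B = ∀ u v → u ∈ B → v ∈ B → ∃[ k ] WalkIn B u v k

  Connected : Set
  Connected = ConnectedIn ⊤

  Dist : Fin n → Fin n → ℕ → Set
  Dist u v k = WalkIn ⊤ u v k × (∀ j → j < k → ¬ WalkIn ⊤ u v j)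

  OnGeodesic : Fin n → Fin n → Fin n → Set
  OnGeodesic x y z = ∃[ a ] ∃[ b ] (Dist x y a × Dist y z b × Dist x z (a + b))

  GeneralPosition : Subset n → Set
  GeneralPosition S = ∀ x y z → x ∈ S → y ∈ S → z ∈ S →
    x ≢ y → y ≢ z → x ≢ z → ¬ OnGeodesic x y z

  IsClique : Subset n → Set
  IsClique B = ∀ u v → u ∈ B → v ∈ B → u ≢ v → Adj u v

  NoCutVertex : Subset n → Set
  NoCutVertex B = ConnectedIn B × (∀ v → v ∈ B → ConnectedIn (B [ v ]≔ outside))

  IsBlock : Subset n → Set
  IsBlock B = (∃[ x ] x ∈ B) × NoCutVertex B ×
    (∀ B′ → B ⊆ B′ → NoCutVertex B′ → B′ ⊆ B)

  IsBlockGraph : Set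
  IsBlockGraph = Connected × (∀ B → IsBlock B → IsClique B)

  LegalMove : Subset n → Subset n → Set
  LegalMove S T = ∃[ u ] ∃[ v ] (u ∈ S × v ∉ S × Adj u v ×
    T ≡ (S [ u ]≔ outside) [ v ]≔ inside × GeneralPosition T)

  Mobile : Subset n → Set
  Mobile S = GeneralPosition S × ∃[ m ] Σ (ℕ → Subset n) λ conf →
    conf 0 ≡ S ×
    (∀ i → i < m → LegalMove (conf i) (conf (suc i))) ×
    (∀ x → ∃[ i ] (i ≤ m × x ∈ conf i))

  IsMaxCard : (Subset n → Set) → ℕ → Set
  IsMaxCard P k = (∃[ S ] (P S × ∣ S ∣ ≡ k)) × (∀ S → P S → ∣ S ∣ ≤ k)

  CliqueNumber : ℕ → Set
  CliqueNumber = IsMaxCard IsClique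

  MobNumber : ℕ → Set
  MobNumber = IsMaxCard Mobile

-- A maximum clique Q is mobile: a robot steps from c ∈ Q to a neighbour outside Q and
-- can then roam the part of G − Q it entered and come back.  In a block graph c
-- separates that region from Q − c, so the roaming robot is equidistant from all the
-- others and the configuration stays in general position.
--
-- Conversely, let S be in general position with |S| > ω(G).  Call c locked if c ∉ S and,
-- whichever robot x we pick, c separates two robots other than x.  A robot moving onto c
-- would lie on a geodesic between two robots it separates, so a locked vertex stays
-- locked and is never visited.  Some vertex is locked: two non-adjacent robots are
-- separated by the second vertex c of a geodesic between them.  If c is not locked, it
-- cuts a single robot x off from the others.  The neighbours of c on geodesics towards
-- the other robots cannot all differ, since with c they would form a clique on |S|
-- vertices; a shared neighbour is not a robot, by general position, and cuts x off
-- again one step further away from x.  This descent is bounded by the distance from x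
-- to any other robot.

module Submission where

open import Defs
open import Data.Empty using (⊥; ⊥-elim)
open import Data.Fin using (Fin; zero; suc; _≟_)
import Data.Fin.Properties as Fin
open import Data.Fin.Properties using (any?)
open import Data.Fin.Subset using (Subset; _∈_; _∉_; _⊆_; _⊃_; ⊤; ∣_∣; inside; outside; ⁅_⁆; ∁)
open import Data.Fin.Subset.Properties
  using (_∈?_; ∈⊤; ⊆-refl; ⊆-trans; nonempty?; Empty-unique; ∣⊥∣≡0; x∈⁅y⁆⇒x≡y; ∣⁅x⁆∣≡1;
         x∈∁p⇒x∉p; x∉p⇒x∈∁p)
open import Data.Fin.Subset.Induction using (⊃-wellFounded)
open import Data.Nat using (ℕ; zero; suc; _+_; _<_; _≤_; _≤?_; z≤n; s≤s)
open import Data.Nat.Induction using (<-rec)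
open import Data.Nat.Properties
  using (<-cmp; <-irrefl; <⇒≱; ≰⇒>; ≤-refl; ≤-trans; ≤-<-trans; n≤1+n; n<1+n; m<n⇒m<1+n; m≤m+n; m≤n+m; m<m+n; 1+n≰n;
         m+1+n≢m; +-comm; +-suc; +-mono-≤; +-monoʳ-≤; +-monoˡ-<; +-monoʳ-<)
open import Data.Unit using (tt) renaming (⊤ to Unit)
open import Data.List using (List; []; _∷_; allFin)
open import Data.List.Relation.Unary.Any using (here; there)
open import Data.List.Membership.Propositional using () renaming (_∈_ to _∈ˡ_)
open import Data.List.Membership.Propositional.Properties using (∈-allFin)
open import Data.Product using (Σ; ∃; ∃-syntax; _×_; _,_; proj₁; proj₂)
open import Data.Sum using (_⊎_; inj₁; inj₂; map₁; map₂; [_,_]′)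
open import Data.Vec using ([]; _∷_; _[_]≔_)
  renaming (here to vhere; there to vthere)
open import Data.Vec.Properties
  using ([]≔-updates; []≔-minimal; lookup∘update; lookup∘update′; []=⇒lookup; lookup⇒[]=)
open import Effect.Monad using (RawMonad)
open import Function using (_∘_; id; flip)
import Induction.WellFounded as WF
open import Level using (0ℓ)
open import Relation.Nullary using (¬_; Dec; yes; no; does)
open import Relation.Nullary.Decidable using (¬¬-excluded-middle; _⊎-dec_; _×-dec_; decidable-stable; toSum)
open import Relation.Nullary.Negation using (¬¬-Monad; ¬¬-map; contradiction)
open import Relation.Unary using (Pred; Decidable)
open import Relation.Binary.Definitions using (tri<; tri≈; tri>)
open import Relation.Binary.PropositionalEquality
  using (_≡_; _≢_; refl; sym; trans; cong; cong₂; subst; subst₂; module ≡-Reasoning)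

open RawMonad (¬¬-Monad {a = 0ℓ}) using (_>>=_; pure)

-- Adjacency is an arbitrary family of types, so distances, blocks and cliques are only
-- available in the double-negation monad; this suffices because they are only ever used
-- to prove negative or decidable statements.
¬¬-Π-Fin : ∀ {n} {P : Fin n → Set} → (∀ i → ¬ ¬ P i) → ¬ ¬ (∀ i → P i)
¬¬-Π-Fin {zero}  ¬¬P k = k (λ ())
¬¬-Π-Fin {suc n} ¬¬P k =
  ¬¬P zero λ P₀ → ¬¬-Π-Fin (¬¬P ∘ suc) λ Pₛ → k λ { zero → P₀ ; (suc i) → Pₛ i }

¬¬-→ : ∀ {A B : Set} → (A → ¬ ¬ B) → ¬ ¬ (A → B)
¬¬-→ f k = k λ a → ⊥-elim (f a λ b → k λ _ → b)

module _ where

  private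
    variable
      m n : ℕ
      p : Subset n
      x y : Fin n

  x∈p[x]≔inside : (p : Subset n) (x : Fin n) → x ∈ p [ x ]≔ inside
  x∈p[x]≔inside = []≔-updates

  x∉p[x]≔outside : (p : Subset n) (x : Fin n) → x ∉ p [ x ]≔ outside
  x∉p[x]≔outside p x x∈ with () ← trans (sym (lookup∘update x p outside)) ([]=⇒lookup x∈)

  x∈p⇒x∈p[y]≔b : ∀ b → x ≢ y → x ∈ p → x ∈ p [ y ]≔ b
  x∈p⇒x∈p[y]≔b {x = x} {y} {p = p} b x≢y = []≔-minimal p x y x≢y

  x∈p[y]≔b⇒x∈p : ∀ {b} → x ≢ y → x ∈ p [ y ]≔ b → x ∈ p
  x∈p[y]≔b⇒x∈p {x = x} {y} {p = p} {b} x≢y x∈ =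
    lookup⇒[]= x p (trans (sym (lookup∘update′ x≢y p b)) ([]=⇒lookup x∈))

  x∈p[y]≔inside⁻ : x ∈ p [ y ]≔ inside → x ≡ y ⊎ x ∈ p
  x∈p[y]≔inside⁻ {x = x} {y = y} x∈ with x ≟ y
  ... | yes x≡y = inj₁ x≡y
  ... | no x≢y  = inj₂ (x∈p[y]≔b⇒x∈p x≢y x∈)

  x∈p[y]≔outside⁻ : x ∈ p [ y ]≔ outside → x ≢ y × x ∈ p
  x∈p[y]≔outside⁻ {x = x} {p = p} {y = y} x∈ with x ≟ y
  ... | yes refl = contradiction x∈ (x∉p[x]≔outside p x)
  ... | no x≢y   = x≢y , x∈p[y]≔b⇒x∈p x≢y x∈

  x∈p∧y∉p⇒x≢y : x ∈ p → y ∉ p → x ≢ y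
  x∈p∧y∉p⇒x≢y x∈p y∉p refl = y∉p x∈p

  ∣p[x]≔inside∣ : (p : Subset n) (x : Fin n) → x ∉ p → ∣ p [ x ]≔ inside ∣ ≡ suc ∣ p ∣
  ∣p[x]≔inside∣ (inside  ∷ p) zero    x∉p = contradiction vhere x∉p
  ∣p[x]≔inside∣ (outside ∷ p) zero    x∉p = refl
  ∣p[x]≔inside∣ (inside  ∷ p) (suc x) x∉p = cong suc (∣p[x]≔inside∣ p x (x∉p ∘ vthere))
  ∣p[x]≔inside∣ (outside ∷ p) (suc x) x∉p = ∣p[x]≔inside∣ p x (x∉p ∘ vthere)

  ∣p[x]≔outside∣ : (p : Subset n) (x : Fin n) → x ∈ p → ∣ p ∣ ≡ suc ∣ p [ x ]≔ outside ∣
  ∣p[x]≔outside∣ (inside  ∷ p) zero    x∈p          = refl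
  ∣p[x]≔outside∣ (inside  ∷ p) (suc x) (vthere x∈p) = cong suc (∣p[x]≔outside∣ p x x∈p)
  ∣p[x]≔outside∣ (outside ∷ p) (suc x) (vthere x∈p) = ∣p[x]≔outside∣ p x x∈p

  p[x]≔inside[x]≔outside : (p : Subset n) (x : Fin n) → x ∉ p → (p [ x ]≔ inside) [ x ]≔ outside ≡ p
  p[x]≔inside[x]≔outside (inside  ∷ p) zero    x∉p = contradiction vhere x∉p
  p[x]≔inside[x]≔outside (outside ∷ p) zero    x∉p = refl
  p[x]≔inside[x]≔outside (b ∷ p)       (suc x) x∉p = cong (b ∷_) (p[x]≔inside[x]≔outside p x (x∉p ∘ vthere))

  p[x]≔outside[x]≔inside : (p : Subset n) (x : Fin n) → x ∈ p → (p [ x ]≔ outside) [ x ]≔ inside ≡ p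
  p[x]≔outside[x]≔inside (inside ∷ p) zero    x∈p          = refl
  p[x]≔outside[x]≔inside (b ∷ p)      (suc x) (vthere x∈p) = cong (b ∷_) (p[x]≔outside[x]≔inside p x x∈p)

  ∣p∣≤∣q∣-injection : (p : Subset m) (q : Subset n) (f : Fin m → Fin n) →
    (∀ {x y} → x ∈ p → y ∈ p → f x ≡ f y → x ≡ y) → (∀ {x} → x ∈ p → f x ∈ q) → ∣ p ∣ ≤ ∣ q ∣
  ∣p∣≤∣q∣-injection []            q f inj into = z≤n
  ∣p∣≤∣q∣-injection (outside ∷ p) q f inj into =
    ∣p∣≤∣q∣-injection p q (f ∘ suc) (λ x∈ y∈ → Fin.suc-injective ∘ inj (vthere x∈) (vthere y∈)) (into ∘ vthere)
  ∣p∣≤∣q∣-injection (inside ∷ p)  q f inj into =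
    subst (suc ∣ p ∣ ≤_) (sym (∣p[x]≔outside∣ q (f zero) (into vhere)))
      (s≤s (∣p∣≤∣q∣-injection p (q [ f zero ]≔ outside) (f ∘ suc)
        (λ x∈ y∈ → Fin.suc-injective ∘ inj (vthere x∈) (vthere y∈))
        (λ x∈ → x∈p⇒x∈p[y]≔b outside (λ eq → Fin.0≢1+n (inj vhere (vthere x∈) (sym eq))) (into (vthere x∈)))))

  ⟦_⟧ : ∀ {ℓ} {P : Pred (Fin n) ℓ} → Decidable P → Subset n
  ⟦_⟧ {zero}  P? = []
  ⟦_⟧ {suc n} P? = does (P? zero) ∷ ⟦ P? ∘ suc ⟧

  ∈⟦⟧⁺ : ∀ {ℓ} {P : Pred (Fin n) ℓ} (P? : Decidable P) → P x → x ∈ ⟦ P? ⟧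
  ∈⟦⟧⁺ {x = zero} P? Px with P? zero
  ... | yes _  = vhere
  ... | no ¬Px = contradiction Px ¬Px
  ∈⟦⟧⁺ {x = suc x} P? Px = vthere (∈⟦⟧⁺ (P? ∘ suc) Px)

  ∈⟦⟧⁻ : ∀ {ℓ} {P : Pred (Fin n) ℓ} (P? : Decidable P) → x ∈ ⟦ P? ⟧ → P x
  ∈⟦⟧⁻ {x = zero} P? x∈ with P? zero | x∈
  ... | yes Px | _ = Px
  ∈⟦⟧⁻ {x = suc x} P? (vthere x∈) = ∈⟦⟧⁻ (P? ∘ suc) x∈

module Walks (G : Graph) where
  open Graph G renaming (sym to adj-sym; irrefl to adj-irrefl)

  private
    variable
      B C : Subset n
      u v w x z : Fin n
      i j k : ℕ

  start∈ : WalkIn G B u v k → u ∈ B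
  start∈ (here u∈B)     = u∈B
  start∈ (step u∈B _ _) = u∈B

  length-zero : WalkIn G B u v 0 → u ≡ v
  length-zero (here _) = refl

  infixr 5 _++ʷ_
  _++ʷ_ : WalkIn G B u w i → WalkIn G B w v j → WalkIn G B u v (i + j)
  here _       ++ʷ q = q
  step b a p   ++ʷ q = step b a (p ++ʷ q)

  snoc : WalkIn G B u w k → Adj w v → v ∈ B → WalkIn G B u v (suc k)
  snoc (here b)     a v∈B = step b a (here v∈B)
  snoc (step b a p) a′ v∈B = step b a (snoc p a′ v∈B)

  reverse : WalkIn G B u v k → WalkIn G B v u k
  reverse (here b)     = here b
  reverse (step b a p) = snoc (reverse p) (adj-sym a) b

  infix 4 _∈ʷ_ _⊆ʷ_
  _∈ʷ_ : Fin n → WalkIn G B u v k → Set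
  z ∈ʷ here {u} _     = z ≡ u
  z ∈ʷ step {u} _ _ p = z ≡ u ⊎ z ∈ʷ p

  _⊆ʷ_ : WalkIn G B u v k → WalkIn G C x z j → Set
  p ⊆ʷ q = ∀ {t} → t ∈ʷ p → t ∈ʷ q

  _∈ʷ?_ : (z : Fin n) (p : WalkIn G B u v k) → Dec (z ∈ʷ p)
  z ∈ʷ? here {u} _ = z ≟ u
  z ∈ʷ? step {u} _ _ p with z ≟ u | z ∈ʷ? p
  ... | yes z≡u | _        = yes (inj₁ z≡u)
  ... | no _    | yes z∈p  = yes (inj₂ z∈p)
  ... | no z≢u  | no z∉p   = no λ { (inj₁ z≡u) → z≢u z≡u ; (inj₂ z∈p) → z∉p z∈p }

  start∈ʷ : (p : WalkIn G B u v k) → u ∈ʷ p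
  start∈ʷ (here _)     = refl
  start∈ʷ (step _ _ _) = inj₁ refl

  end∈ʷ : (p : WalkIn G B u v k) → v ∈ʷ p
  end∈ʷ (here _)     = refl
  end∈ʷ (step _ _ p) = inj₂ (end∈ʷ p)

  ∈ʷ⇒∈ : (p : WalkIn G B u v k) → z ∈ʷ p → z ∈ B
  ∈ʷ⇒∈ (here b)     refl        = b
  ∈ʷ⇒∈ (step b _ _) (inj₁ refl) = b
  ∈ʷ⇒∈ (step _ _ p) (inj₂ z∈p)  = ∈ʷ⇒∈ p z∈p

  ∈ʷ-snoc⁻ : ∀ (p : WalkIn G B u w k) {a : Adj w v} {v∈B : v ∈ B} → z ∈ʷ snoc p a v∈B → z ∈ʷ p ⊎ z ≡ v
  ∈ʷ-snoc⁻ (here _)     (inj₁ z≡u) = inj₁ z≡u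
  ∈ʷ-snoc⁻ (here _)     (inj₂ z≡v) = inj₂ z≡v
  ∈ʷ-snoc⁻ (step _ _ p) (inj₁ z≡u) = inj₁ (inj₁ z≡u)
  ∈ʷ-snoc⁻ (step _ _ p) (inj₂ z∈)  = map₁ inj₂ (∈ʷ-snoc⁻ p z∈)

  restrict : (p : WalkIn G B u v k) → (∀ {t} → t ∈ʷ p → t ∈ C) → WalkIn G C u v k
  restrict (here _)     into = here (into refl)
  restrict (step _ a p) into = step (into (inj₁ refl)) a (restrict p (into ∘ inj₂))

  avoid-or-split : (p : WalkIn G B u v k) (c : Fin n) →
    ¬ c ∈ʷ p ⊎ ∃[ i ] ∃[ j ] (i + j ≡ k × WalkIn G B u c i × WalkIn G B c v j)
  avoid-or-split (here {u} b) c with c ≟ u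
  ... | yes refl = inj₂ (0 , 0 , refl , here b , here b)
  ... | no c≢u   = inj₁ c≢u
  avoid-or-split (step {u} b a p) c with c ≟ u | avoid-or-split p c
  ... | yes refl | _ = inj₂ (0 , _ , refl , here b , step b a p)
  ... | no c≢u | inj₁ c∉p = inj₁ λ { (inj₁ c≡u) → c≢u c≡u ; (inj₂ c∈p) → c∉p c∈p }
  ... | no _   | inj₂ (i , j , i+j≡k , p₁ , p₂) = inj₂ (suc i , j , cong suc i+j≡k , step b a p₁ , p₂)

  Simple : WalkIn G B u v k → Set
  Simple (here _)         = Unit
  Simple (step {u} _ _ p) = ¬ u ∈ʷ p × Simple p

  suffix : (p : WalkIn G B u v k) → z ∈ʷ p →
    ∃ λ j → Σ (WalkIn G B z v j) λ q → q ⊆ʷ p × (Simple p → Simple q)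
  suffix (here b)     refl        = 0 , here b , id , id
  suffix (step b a p) (inj₁ refl) = _ , step b a p , id , id
  suffix (step b a p) (inj₂ z∈p) with suffix p z∈p
  ... | j , q , q⊆p , simple = j , q , inj₂ ∘ q⊆p , simple ∘ proj₂

  reversed-prefix : (p : WalkIn G B u v k) → z ∈ʷ p → ∃ λ i → Σ (WalkIn G B z u i) (_⊆ʷ p)
  reversed-prefix (here b)     refl        = 0 , here b , id
  reversed-prefix (step b a p) (inj₁ refl) = 0 , here b , inj₁
  reversed-prefix (step b a p) (inj₂ z∈p) with reversed-prefix p z∈p
  ... | i , r , r⊆p = suc i , snoc r (adj-sym a) b , [ inj₂ ∘ r⊆p , inj₁ ]′ ∘ ∈ʷ-snoc⁻ r

  erase : WalkIn G B u v k → ∃ λ k′ → Σ (WalkIn G B u v k′) Simple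
  erase (here b) = 0 , here b , tt
  erase (step {u} b a p) with erase p
  ... | _ , q , simple-q with u ∈ʷ? q
  ...   | yes u∈q = let j , r , _ , simple = suffix q u∈q in j , r , simple simple-q
  ...   | no  u∉q = _ , step b a q , u∉q , simple-q

  AvoidingWalk : WalkIn G B u v k → Fin n → Fin n → Fin n → Set
  AvoidingWalk {B = B} p x z y = ∃ λ i → Σ (WalkIn G B z y i) λ r → r ⊆ʷ p × ¬ x ∈ʷ r

  simple-avoid-to-an-end : (p : WalkIn G B u v k) → Simple p → x ∈ʷ p → z ∈ʷ p → z ≢ x →
                           AvoidingWalk p x z u ⊎ AvoidingWalk p x z v
  simple-avoid-to-an-end (here _) _ refl refl z≢x = contradiction refl z≢x
  simple-avoid-to-an-end (step b a p) _ _ (inj₁ refl) z≢x =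
    inj₁ (0 , here b , inj₁ , λ x≡z → z≢x (sym x≡z))
  simple-avoid-to-an-end (step b a p) (u∉p , _) (inj₁ refl) (inj₂ z∈p) _ =
    let j , q , q⊆p , _ = suffix p z∈p in inj₂ (j , q , inj₂ ∘ q⊆p , u∉p ∘ q⊆p)
  simple-avoid-to-an-end (step b a p) (u∉p , simple-p) (inj₂ x∈p) (inj₂ z∈p) z≢x
    with simple-avoid-to-an-end p simple-p x∈p z∈p z≢x
  ... | inj₂ (i , r , r⊆p , x∉r) = inj₂ (i , r , inj₂ ∘ r⊆p , x∉r)
  ... | inj₁ (i , r , r⊆p , x∉r) =
    inj₁ (suc i , snoc r (adj-sym a) b , [ inj₂ ∘ r⊆p , inj₁ ]′ ∘ ∈ʷ-snoc⁻ r ,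
          [ x∉r , (λ { refl → u∉p x∈p }) ]′ ∘ ∈ʷ-snoc⁻ r)

module Separation (G : Graph) where
  open Graph G renaming (sym to adj-sym; irrefl to adj-irrefl)
  open Walks G

  private
    variable
      B : Subset n
      x y z c : Fin n
      k : ℕ

  Avoid : Fin n → Subset n
  Avoid c = ⊤ [ c ]≔ outside

  ≢⇒∈Avoid : z ≢ c → z ∈ Avoid c
  ≢⇒∈Avoid z≢c = x∈p⇒x∈p[y]≔b outside z≢c ∈⊤

  ∈Avoid⇒≢ : z ∈ Avoid c → z ≢ c
  ∈Avoid⇒≢ = proj₁ ∘ x∈p[y]≔outside⁻

  ConnAvoiding : Fin n → Fin n → Fin n → Set
  ConnAvoiding c y z = ∃ (WalkIn G (Avoid c) y z)

  Separates : Fin n → Fin n → Fin n → Set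
  Separates c y z = ¬ ConnAvoiding c y z

  conn-sym : ConnAvoiding c y z → ConnAvoiding c z y
  conn-sym (_ , p) = _ , reverse p

  conn-trans : ConnAvoiding c x y → ConnAvoiding c y z → ConnAvoiding c x z
  conn-trans (_ , p) (_ , q) = _ , p ++ʷ q

  conn-refl : y ≢ c → ConnAvoiding c y y
  conn-refl y≢c = 0 , here (≢⇒∈Avoid y≢c)

  conn-adj : y ≢ c → z ≢ c → Adj y z → ConnAvoiding c y z
  conn-adj y≢c z≢c a = 1 , step (≢⇒∈Avoid y≢c) a (here (≢⇒∈Avoid z≢c))

  walk-avoiding⇒conn : (p : WalkIn G B y z k) → ¬ c ∈ʷ p → ConnAvoiding c y z
  walk-avoiding⇒conn p c∉p = _ , restrict p λ {t} t∈p → ≢⇒∈Avoid λ { refl → c∉p t∈p }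

  sep-sym : Separates c y z → Separates c z y
  sep-sym sep = sep ∘ conn-sym

  sep-through : Separates c x z → Separates y c z → Separates y x z
  sep-through {c} sep-c sep-y (_ , p) with avoid-or-split p c
  ... | inj₁ c∉p = sep-c (walk-avoiding⇒conn p c∉p)
  ... | inj₂ (_ , _ , _ , _ , p₂) = sep-y (_ , p₂)

module Distance (G : Graph) where
  open Graph G renaming (sym to adj-sym; irrefl to adj-irrefl)
  open Walks G
  open Separation G

  private
    variable
      u v c : Fin n
      d e k : ℕ

  dist-exists : WalkIn G ⊤ u v k → ¬ ¬ ∃ (Dist G u v)
  dist-exists {u = u} {v} {k} = <-rec (λ k → WalkIn G ⊤ u v k → ¬ ¬ ∃ (Dist G u v)) shorten k
    where
    shorten : ∀ k → (∀ {j} → j < k → WalkIn G ⊤ u v j → ¬ ¬ ∃ (Dist G u v)) →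
              WalkIn G ⊤ u v k → ¬ ¬ ∃ (Dist G u v)
    shorten k shorter-exists p = do
      no no-shorter ← ¬¬-excluded-middle {A = ∃[ j ] (j < k × WalkIn G ⊤ u v j)}
        where yes (j , j<k , q) → shorter-exists j<k q
      pure (k , p , λ j j<k q → no-shorter (j , j<k , q))

  dist-unique : Dist G u v d → Dist G u v e → d ≡ e
  dist-unique {d = d} {e} (p , p-min) (q , q-min) with <-cmp d e
  ... | tri< d<e _ _ = contradiction p (q-min d d<e)
  ... | tri≈ _ d≡e _ = d≡e
  ... | tri> _ _ e<d = contradiction q (p-min e e<d)

  dist-sym : Dist G u v d → Dist G v u d
  dist-sym (p , p-min) = reverse p , λ j j<d q → p-min j j<d (reverse q)

  adj⇒dist1 : Adj u v → Dist G u v 1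
  adj⇒dist1 a = step ∈⊤ a (here ∈⊤) , λ
    { zero _ q → adj-irrefl (subst (Adj _) (sym (length-zero q)) a)
    ; (suc j) (s≤s ()) _ }

  ≢⇒dist>0 : u ≢ v → Dist G u v d → 0 < d
  ≢⇒dist>0 {d = zero}  u≢v (p , _) = contradiction (length-zero p) u≢v
  ≢⇒dist>0 {d = suc d} _   _       = s≤s z≤n

  geodesic-split : (D : Dist G u v d) → c ∈ʷ proj₁ D →
    ∃[ i ] ∃[ j ] (i + j ≡ d × Dist G u c i × Dist G c v j)
  geodesic-split (p , p-min) c∈p with avoid-or-split p _
  ... | inj₁ c∉p = contradiction c∈p c∉p
  ... | inj₂ (i , j , refl , p₁ , p₂) =
    i , j , refl , (p₁ , λ i′ i′<i q → p-min (i′ + j) (+-monoˡ-< j i′<i) (q ++ʷ p₂))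
                 , (p₂ , λ j′ j′<j q → p-min (i + j′) (+-monoʳ-< i j′<j) (p₁ ++ʷ q))

  separator-splits-geodesic : ∀ {c y z d} → Separates c y z → Dist G y z d →
    ∃[ i ] ∃[ j ] (i + j ≡ d × Dist G y c i × Dist G c z j)
  separator-splits-geodesic {c} sep D with c ∈ʷ? proj₁ D
  ... | yes c∈p = geodesic-split D c∈p
  ... | no  c∉p = contradiction (walk-avoiding⇒conn (proj₁ D) c∉p) sep

  module _ {u y v e} (a : Adj u y) (q : WalkIn G ⊤ y v e) (min : ∀ j → j < suc e → ¬ WalkIn G ⊤ u v j) where

    geodesic-tail : Dist G y v e
    geodesic-tail = q , λ j j<e q′ → min (suc j) (s≤s j<e) (step ∈⊤ a q′)

    start∉geodesic-tail : ¬ u ∈ʷ q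
    start∉geodesic-tail u∈q =
      let i , j , i+j≡e , _ , (r , _) = geodesic-split geodesic-tail u∈q
      in min j (s≤s (subst (j ≤_) i+j≡e (m≤n+m j i))) r

module Blocks (G : Graph) where
  open Graph G renaming (sym to adj-sym; irrefl to adj-irrefl)
  open Walks G
  open Separation G

  connected-via-hub : ∀ (C : Subset n) {h} → h ∈ C → (∀ {z} → z ∈ C → ∃ (WalkIn G C z h)) → ConnectedIn G C
  connected-via-hub C h∈C to-hub x y x∈C y∈C =
    let _ , p = to-hub x∈C ; _ , q = to-hub y∈C in _ , p ++ʷ reverse q

  module Cycle {u v w k} (u~v : Adj u v) (v~w : Adj v w) (P : WalkIn G (Avoid v) u w k) (simple : Simple P) where

    Cyc : Subset n
    Cyc = ⟦ (λ z → z ≟ v ⊎-dec z ∈ʷ? P) ⟧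

    v∈Cyc : v ∈ Cyc
    v∈Cyc = ∈⟦⟧⁺ _ (inj₁ refl)

    on-P⇒∈Cyc : ∀ {z} → z ∈ʷ P → z ∈ Cyc
    on-P⇒∈Cyc = ∈⟦⟧⁺ _ ∘ inj₂

    on-P⇒≢v : ∀ {z} → z ∈ʷ P → z ≢ v
    on-P⇒≢v = ∈Avoid⇒≢ ∘ ∈ʷ⇒∈ P

    Cyc-connected : ConnectedIn G Cyc
    Cyc-connected = connected-via-hub Cyc v∈Cyc to-v
      where
      to-v : ∀ {z} → z ∈ Cyc → ∃ (WalkIn G Cyc z v)
      to-v z∈ with ∈⟦⟧⁻ _ z∈
      ... | inj₁ refl = 0 , here v∈Cyc
      ... | inj₂ z∈P  = let i , r , r⊆P = reversed-prefix P z∈P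
                        in suc i , snoc (restrict r (on-P⇒∈Cyc ∘ r⊆P)) u~v v∈Cyc

    module _ {x : Fin n} where

      Cyc∖x : Subset n
      Cyc∖x = Cyc [ x ]≔ outside

      along-P : ∀ {z y i} (r : WalkIn G (Avoid v) z y i) → r ⊆ʷ P → ¬ x ∈ʷ r → WalkIn G Cyc∖x z y i
      along-P r r⊆P x∉r = restrict r λ t∈r →
        x∈p⇒x∈p[y]≔b outside (λ { refl → x∉r t∈r }) (on-P⇒∈Cyc (r⊆P t∈r))

    Cyc∖v-connected : ConnectedIn G (Cyc∖x {v})
    Cyc∖v-connected = connected-via-hub Cyc∖x u∈ to-u
      where
      u∈ : u ∈ Cyc∖x
      u∈ = x∈p⇒x∈p[y]≔b outside (on-P⇒≢v (start∈ʷ P)) (on-P⇒∈Cyc (start∈ʷ P))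
      to-u : ∀ {z} → z ∈ Cyc∖x → ∃ (WalkIn G Cyc∖x z u)
      to-u z∈ with x∈p[y]≔outside⁻ z∈
      ... | z≢v , z∈Cyc with ∈⟦⟧⁻ _ z∈Cyc
      ...   | inj₁ z≡v = contradiction z≡v z≢v
      ...   | inj₂ z∈P = let i , r , r⊆P = reversed-prefix P z∈P
                         in i , along-P r r⊆P λ v∈r → on-P⇒≢v (r⊆P v∈r) refl

    Cyc∖x-connected : ∀ {x} → x ∈ʷ P → ConnectedIn G (Cyc∖x {x})
    Cyc∖x-connected {x} x∈P = connected-via-hub Cyc∖x v∈ to-v
      where
      v∈ : v ∈ Cyc∖x
      v∈ = x∈p⇒x∈p[y]≔b outside (λ v≡x → on-P⇒≢v x∈P (sym v≡x)) v∈Cyc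
      to-v : ∀ {z} → z ∈ Cyc∖x → ∃ (WalkIn G Cyc∖x z v)
      to-v z∈ with x∈p[y]≔outside⁻ z∈
      ... | z≢x , z∈Cyc with ∈⟦⟧⁻ _ z∈Cyc
      ...   | inj₁ refl = 0 , here v∈
      ...   | inj₂ z∈P with simple-avoid-to-an-end P simple x∈P z∈P z≢x
      ...     | inj₁ (i , r , r⊆P , x∉r) = suc i , snoc (along-P r r⊆P x∉r) u~v v∈
      ...     | inj₂ (i , r , r⊆P , x∉r) = suc i , snoc (along-P r r⊆P x∉r) (adj-sym v~w) v∈

    Cyc-noCutVertex : NoCutVertex G Cyc
    Cyc-noCutVertex = Cyc-connected , Cyc∖-connected
      where
      Cyc∖-connected : ∀ x → x ∈ Cyc → ConnectedIn G (Cyc [ x ]≔ outside)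
      Cyc∖-connected x x∈ with ∈⟦⟧⁻ _ x∈
      ... | inj₁ refl = Cyc∖v-connected
      ... | inj₂ x∈P  = Cyc∖x-connected x∈P

  ¬¬-block-⊇ : ∀ B → (∃ λ x → x ∈ B) → NoCutVertex G B → ¬ ¬ ∃ λ B′ → B ⊆ B′ × IsBlock G B′
  ¬¬-block-⊇ = WF.All.wfRec (⊃-wellFounded {n = n}) _ _ extend
    where
    Extensible : Subset n → Set
    Extensible B = ∃ λ B′ → B ⊆ B′ × NoCutVertex G B′ × ∃ λ x → x ∈ B′ × x ∉ B
    widen : ∀ {B B′} → B ⊆ B′ → (∃ λ B″ → B′ ⊆ B″ × IsBlock G B″) →
            ∃ λ B″ → B ⊆ B″ × IsBlock G B″
    widen B⊆B′ (B″ , B′⊆B″ , block) = B″ , ⊆-trans B⊆B′ B′⊆B″ , block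
    extend : ∀ B →
             (∀ {B′} → B′ ⊃ B → (∃ λ x → x ∈ B′) → NoCutVertex G B′ → ¬ ¬ ∃ λ B″ → B′ ⊆ B″ × IsBlock G B″) →
             (∃ λ x → x ∈ B) → NoCutVertex G B → ¬ ¬ ∃ λ B′ → B ⊆ B′ × IsBlock G B′
    extend B rec nonempty ncv = do
      no maximal ← ¬¬-excluded-middle {A = Extensible B}
        where yes (B′ , B⊆B′ , ncv′ , x , x∈B′ , x∉B) →
                ¬¬-map (widen B⊆B′) (rec {B′} (B⊆B′ , x , x∈B′ , x∉B) (x , x∈B′) ncv′)
      pure (maximal⇒block maximal)
      where
      maximal⇒block : ¬ Extensible B → ∃ λ B′ → B ⊆ B′ × IsBlock G B′
      maximal⇒block maximal = B , ⊆-refl , nonempty , ncv , λ B′ B⊆B′ ncv′ {y} y∈B′ →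
        decidable-stable (y ∈? B) λ y∉B → maximal (B′ , B⊆B′ , ncv′ , y , y∈B′ , y∉B)

  avoiding-path⇒adj : IsBlockGraph G → ∀ {u v w} → Adj u v → Adj v w → u ≢ w → ConnAvoiding v u w → ¬ ¬ Adj u w
  avoiding-path⇒adj (_ , blocks-are-cliques) {u} {v} {w} u~v v~w u≢w (_ , p) with erase p
  ... | _ , P , simple = ¬¬-map edge-of-block (¬¬-block-⊇ Cyc (v , v∈Cyc) Cyc-noCutVertex)
    where
    open Cycle u~v v~w P simple
    edge-of-block : (∃ λ B → Cyc ⊆ B × IsBlock G B) → Adj u w
    edge-of-block (B , Cyc⊆B , block) =
      blocks-are-cliques B block u w (Cyc⊆B (on-P⇒∈Cyc (start∈ʷ P))) (Cyc⊆B (on-P⇒∈Cyc (end∈ʷ P))) u≢w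

module BlockGraph (G : Graph) (block-graph : IsBlockGraph G) where
  open Graph G renaming (sym to adj-sym; irrefl to adj-irrefl)
  open Walks G
  open Separation G
  open Distance G
  open Blocks G

  private
    variable
      u v x y z c : Fin n
      e i j : ℕ

  ¬¬-dist : ∀ u v → ¬ ¬ ∃ (Dist G u v)
  ¬¬-dist u v = dist-exists (proj₂ (proj₁ block-graph u v ∈⊤ ∈⊤))

  separator-on-geodesic : Separates c y z → ¬ ¬ OnGeodesic G y c z
  separator-on-geodesic {c} {y} {z} sep = ¬¬-map on-geodesic (¬¬-dist y z)
    where
    on-geodesic : ∃ (Dist G y z) → OnGeodesic G y c z
    on-geodesic (d , D) with separator-splits-geodesic sep D
    ... | i , j , refl , Dyc , Dcz = i , j , Dyc , Dcz , D

  separator-dist : Separates c x z → Dist G x c i → Dist G c z j → ¬ ¬ Dist G x z (i + j)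
  separator-dist {c} {x} {z} {i} {j} sep Dxc Dcz = ¬¬-map through-c (¬¬-dist x z)
    where
    through-c : ∃ (Dist G x z) → Dist G x z (i + j)
    through-c (d , D) with separator-splits-geodesic sep D
    ... | _ , _ , refl , Dxc′ , Dcz′ = subst (Dist G x z) (cong₂ _+_ (dist-unique Dxc′ Dxc) (dist-unique Dcz′ Dcz)) D

  geodesic-successor-separates : (a : Adj u y) (q : WalkIn G ⊤ y v e) →
    (∀ j → j < suc e → ¬ WalkIn G ⊤ u v j) → y ≢ v → Separates y u v
  geodesic-successor-separates a (here _) min y≢v _ = y≢v refl
  geodesic-successor-separates {u} {e = suc e} a q@(step {w = y₂} _ b q₂) min _ conn =
    avoiding-path⇒adj block-graph (adj-sym b) (adj-sym a) y₂≢u y₂⇝u λ y₂~u →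
      min (suc e) (n<1+n (suc e)) (step ∈⊤ (adj-sym y₂~u) q₂)
    where
    y₂≢u : y₂ ≢ u
    y₂≢u refl = min e (m<n⇒m<1+n (n<1+n e)) q₂
    y₂⇝u : ConnAvoiding _ y₂ u
    y₂⇝u = conn-trans (walk-avoiding⇒conn q₂ (start∉geodesic-tail b q₂ (proj₂ (geodesic-tail a q min))))
                      (conn-sym conn)

  record Gate (c r : Fin n) : Set where
    field
      vertex      : Fin n
      adjacent    : Adj c vertex
      {len}       : ℕ
      vertex-dist : Dist G vertex r len
      dist        : Dist G c r (suc len)
      conn        : ConnAvoiding c vertex r
      separates   : vertex ≡ r ⊎ Separates vertex c r

  ¬¬-gate : c ≢ z → ¬ ¬ Gate c z
  ¬¬-gate {c} {z} c≢z = ¬¬-map gate-of-geodesic (¬¬-dist c z)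
    where
    gate-of-geodesic : ∃ (Dist G c z) → Gate c z
    gate-of-geodesic (_ , here _ , _) = contradiction refl c≢z
    gate-of-geodesic (_ , step {w = y} _ c~y q , min) = record
      { vertex      = y
      ; adjacent    = c~y
      ; vertex-dist = geodesic-tail c~y q min
      ; dist        = step ∈⊤ c~y q , min
      ; conn        = walk-avoiding⇒conn q (start∉geodesic-tail c~y q min)
      ; separates   = map₂ (geodesic-successor-separates c~y q min) (toSum (y ≟ z))
      }

module Runs (G : Graph) where
  open Graph G using (n)

  private
    variable
      S T U : Subset n
      x : Fin n
      i l m : ℕ

  infixr 5 _∷_ _++ʳ_
  data Run : Subset n → Subset n → ℕ → Set where
    []  : Run S S 0
    _∷_ : LegalMove G S T → Run T U m → Run S U (suc m)

  config : Run S U m → ℕ → Subset n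
  config {S} []      _       = S
  config {S} (_ ∷ r) zero    = S
  config     (_ ∷ r) (suc i) = config r i

  config-start : (r : Run S U m) → config r 0 ≡ S
  config-start []      = refl
  config-start (_ ∷ r) = refl

  config-end : (r : Run S U m) → config r m ≡ U
  config-end []      = refl
  config-end (_ ∷ r) = config-end r

  config-legal : (r : Run S U m) → ∀ i → i < m → LegalMove G (config r i) (config r (suc i))
  config-legal (mv ∷ r) zero    _         = subst (LegalMove G _) (sym (config-start r)) mv
  config-legal (_  ∷ r) (suc i) (s≤s i<m) = config-legal r i i<m

  _++ʳ_ : Run S T m → Run T U l → Run S U (m + l)
  []       ++ʳ r = r
  (mv ∷ r) ++ʳ r′ = mv ∷ (r ++ʳ r′)

  config-++ˡ : (r : Run S T m) (r′ : Run T U l) → i ≤ m → config (r ++ʳ r′) i ≡ config r i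
  config-++ˡ {i = zero}  []      r′ _         = config-start r′
  config-++ˡ {i = zero}  (_ ∷ r) r′ _         = refl
  config-++ˡ {i = suc i} (_ ∷ r) r′ (s≤s i≤m) = config-++ˡ r r′ i≤m

  config-++ʳ : (r : Run S T m) (r′ : Run T U l) → config (r ++ʳ r′) (m + i) ≡ config r′ i
  config-++ʳ []      r′ = refl
  config-++ʳ (_ ∷ r) r′ = config-++ʳ r r′

  Visits : Run S U m → Fin n → Set
  Visits {m = m} r x = ∃[ i ] (i ≤ m × x ∈ config r i)

  visits-++ˡ : (r : Run S T m) (r′ : Run T U l) → Visits r x → Visits (r ++ʳ r′) x
  visits-++ˡ {m = m} {l = l} r r′ (i , i≤m , x∈) =
    i , ≤-trans i≤m (m≤m+n m l) , subst (_ ∈_) (sym (config-++ˡ r r′ i≤m)) x∈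

  visits-++ʳ : (r : Run S T m) (r′ : Run T U l) → Visits r′ x → Visits (r ++ʳ r′) x
  visits-++ʳ {m = m} r r′ (i , i≤l , x∈) = m + i , +-monoʳ-≤ m i≤l , subst (_ ∈_) (sym (config-++ʳ r r′)) x∈

  visits-start : (r : Run S U m) → x ∈ S → Visits r x
  visits-start r x∈ = 0 , z≤n , subst (_ ∈_) (sym (config-start r)) x∈

  visits-end : (r : Run S U m) → x ∈ U → Visits r x
  visits-end {m = m} r x∈ = m , ≤-refl , subst (_ ∈_) (sym (config-end r)) x∈

  closed-run⇒mobile : GeneralPosition G S → (r : Run S S m) → (∀ x → Visits r x) → Mobile G S
  closed-run⇒mobile {m = m} gp r visits = gp , m , config r , config-start r , config-legal r , visits

module Cliques (G : Graph) where
  open Graph G renaming (sym to adj-sym; irrefl to adj-irrefl)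
  open Distance G

  private
    variable
      Q : Subset n
      x y z a b : Fin n
      d : ℕ

  ¬¬-clique : (∀ u v → u ∈ Q → v ∈ Q → u ≢ v → ¬ ¬ Adj u v) → ¬ ¬ IsClique G Q
  ¬¬-clique adj = ¬¬-Π-Fin λ u → ¬¬-Π-Fin λ v → ¬¬-→ λ u∈Q → ¬¬-→ λ v∈Q → ¬¬-→ (adj u v u∈Q v∈Q)

  on-geodesic-sym : OnGeodesic G x y z → OnGeodesic G z y x
  on-geodesic-sym (p , q , Dxy , Dyz , Dxz) = q , p , dist-sym Dyz , dist-sym Dxy , subst (Dist G _ _) (+-comm p q) (dist-sym Dxz)

  adjacent-ends⇒¬on-geodesic : Adj x z → x ≢ y → y ≢ z → ¬ OnGeodesic G x y z
  adjacent-ends⇒¬on-geodesic x~z x≢y y≢z (p , q , Dxy , Dyz , Dxz) =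
    1+n≰n (subst (2 ≤_) (dist-unique Dxz (adj⇒dist1 x~z)) (+-mono-≤ (≢⇒dist>0 x≢y Dxy) (≢⇒dist>0 y≢z Dyz)))

  equidistant-ends⇒¬on-geodesic : Dist G z a d → Dist G z b d → Adj b a → ¬ OnGeodesic G z b a
  equidistant-ends⇒¬on-geodesic Dza Dzb b~a (p , q , Dzb′ , Dba , Dza′)
    rewrite dist-unique Dzb′ Dzb | dist-unique Dba (adj⇒dist1 b~a) = m+1+n≢m _ (dist-unique Dza′ Dza)

  clique⇒general-position : IsClique G Q → GeneralPosition G Q
  clique⇒general-position clique x y z x∈ _ z∈ x≢y y≢z x≢z =
    adjacent-ends⇒¬on-geodesic (clique x z x∈ z∈ x≢z) x≢y y≢z

  clique+equidistant⇒general-position : IsClique G Q → (∀ {a} → a ∈ Q → ¬ ¬ Dist G z a d) →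
                                        GeneralPosition G (Q [ z ]≔ inside)
  clique+equidistant⇒general-position {Q} {z} clique equidistant x y w x∈ y∈ w∈ x≢y y≢w x≢w geo
    with x∈p[y]≔inside⁻ x∈ | x∈p[y]≔inside⁻ w∈
  ... | inj₂ x∈Q  | inj₂ w∈Q  = adjacent-ends⇒¬on-geodesic (clique x w x∈Q w∈Q x≢w) x≢y y≢w geo
  ... | inj₁ refl | inj₁ refl = x≢w refl
  ... | inj₁ refl | inj₂ w∈Q  = let y∈Q = x∈p[y]≔b⇒x∈p (x≢y ∘ sym) y∈ in
    equidistant w∈Q λ Dzw → equidistant y∈Q λ Dzy →
      equidistant-ends⇒¬on-geodesic Dzw Dzy (clique y w y∈Q w∈Q y≢w) geo
  ... | inj₂ x∈Q  | inj₁ refl = let y∈Q = x∈p[y]≔b⇒x∈p y≢w y∈ in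
    equidistant x∈Q λ Dzx → equidistant y∈Q λ Dzy →
      equidistant-ends⇒¬on-geodesic Dzx Dzy (clique y x y∈Q x∈Q (x≢y ∘ sym)) (on-geodesic-sym geo)

module MaximumClique (G : Graph) (block-graph : IsBlockGraph G) {Q : Subset (Graph.n G)}
                     (clique : IsClique G Q) (maximum : ∀ S → IsClique G S → ∣ S ∣ ≤ ∣ Q ∣) where
  open Graph G renaming (sym to adj-sym; irrefl to adj-irrefl)
  open Walks G
  open Separation G
  open Distance G
  open Blocks G
  open BlockGraph G block-graph
  open Cliques G
  open Runs G

  private
    variable
      a c y z : Fin n

  ¬adjacent-to-all : y ∉ Q → ¬ (∀ {a} → a ∈ Q → ¬ ¬ Adj y a)
  ¬adjacent-to-all {y} y∉Q y~Q = ¬¬-clique pairs λ clique′ →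
    1+n≰n (subst (_≤ ∣ Q ∣) (∣p[x]≔inside∣ Q y y∉Q) (maximum _ clique′))
    where
    pairs : ∀ u v → u ∈ Q [ y ]≔ inside → v ∈ Q [ y ]≔ inside → u ≢ v → ¬ ¬ Adj u v
    pairs u v u∈ v∈ u≢v with x∈p[y]≔inside⁻ u∈ | x∈p[y]≔inside⁻ v∈
    ... | inj₁ refl | inj₁ refl = contradiction refl u≢v
    ... | inj₁ refl | inj₂ v∈Q  = y~Q v∈Q
    ... | inj₂ u∈Q  | inj₁ refl = ¬¬-map adj-sym (y~Q u∈Q)
    ... | inj₂ u∈Q  | inj₂ v∈Q  = pure (clique u v u∈Q v∈Q u≢v)

  exit-separated : c ∈ Q → Adj c y → y ∉ Q → a ∈ Q → a ≢ c → Separates c y a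
  exit-separated {c} {y} {a} c∈Q c~y y∉Q a∈Q a≢c y⇝a = ¬adjacent-to-all y∉Q y~Q
    where
    y≢ : ∀ {a} → a ∈ Q → y ≢ a
    y≢ a∈Q refl = y∉Q a∈Q
    y~a : ¬ ¬ Adj y a
    y~a = avoiding-path⇒adj block-graph (adj-sym c~y) (clique c a c∈Q a∈Q (a≢c ∘ sym)) (y≢ a∈Q) y⇝a
    y~Q : ∀ {a′} → a′ ∈ Q → ¬ ¬ Adj y a′
    y~Q {a′} a′∈Q with a′ ≟ c | a′ ≟ a
    ... | yes refl | _        = pure (adj-sym c~y)
    ... | no  _    | yes refl = y~a
    ... | no a′≢c  | no a′≢a  = do
      y~a ← y~a
      avoiding-path⇒adj block-graph y~a (clique a a′ a∈Q a′∈Q (a′≢a ∘ sym)) (y≢ a′∈Q)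
        (conn-trans (conn-adj (y≢ a∈Q) (a≢c ∘ sym) (adj-sym c~y))
                    (conn-adj (a≢c ∘ sym) a′≢a (clique c a′ c∈Q a′∈Q (a′≢c ∘ sym))))

  module Excursion {c y} (c∈Q : c ∈ Q) (c~y : Adj c y) (y∉Q : y ∉ Q) where

    Q∖c : Subset n
    Q∖c = Q [ c ]≔ outside

    Config : Fin n → Subset n
    Config z = Q∖c [ z ]≔ inside

    OutsideQ : Fin n → Fin n → Set
    OutsideQ u v = ∃ (WalkIn G (∁ Q) u v)

    ∁Q⇒≢c : z ∈ ∁ Q → z ≢ c
    ∁Q⇒≢c z∈∁Q refl = x∈∁p⇒x∉p z∈∁Q c∈Q

    ∁Q⇒∉Q∖c : z ∈ ∁ Q → z ∉ Q∖c
    ∁Q⇒∉Q∖c z∈∁Q = x∈∁p⇒x∉p z∈∁Q ∘ proj₂ ∘ x∈p[y]≔outside⁻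

    -- c separates the roaming robot z from every robot of Q∖c, so they are all at distance d(z,c) + 1.
    config-general-position : OutsideQ y z → GeneralPosition G (Config z)
    config-general-position {z} (_ , W) x₁ x₂ x₃ x₁∈ x₂∈ x₃∈ x₁≢x₂ x₂≢x₃ x₁≢x₃ geo =
      ¬¬-dist z c λ (e , Dzc) →
        clique+equidistant⇒general-position {d = e + 1} clique∖c (equidistant Dzc)
          x₁ x₂ x₃ x₁∈ x₂∈ x₃∈ x₁≢x₂ x₂≢x₃ x₁≢x₃ geo
      where
      clique∖c : IsClique G Q∖c
      clique∖c u v u∈ v∈ = clique u v (proj₂ (x∈p[y]≔outside⁻ u∈)) (proj₂ (x∈p[y]≔outside⁻ v∈))
      z-separated : ∀ {a} → a ∈ Q → a ≢ c → Separates c z a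
      z-separated a∈Q a≢c z⇝a = exit-separated c∈Q c~y y∉Q a∈Q a≢c
        (conn-trans (_ , restrict W (≢⇒∈Avoid ∘ ∁Q⇒≢c ∘ ∈ʷ⇒∈ W)) z⇝a)
      equidistant : ∀ {e} → Dist G z c e → ∀ {a} → a ∈ Q∖c → ¬ ¬ Dist G z a (e + 1)
      equidistant Dzc a∈ = let a≢c , a∈Q = x∈p[y]≔outside⁻ a∈ in
        separator-dist (z-separated a∈Q a≢c) Dzc (adj⇒dist1 (clique c _ c∈Q a∈Q (a≢c ∘ sym)))

    walk-run : ∀ {z x l} → (W : WalkIn G (∁ Q) z x l) → OutsideQ y z → Run (Config z) (Config x) l
    walk-run (here _) _ = []
    walk-run {z} (step {w = z₁} z∈∁Q z~z₁ W) (_ , y⇝z) = move ∷ walk-run W y⇝z₁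
      where
      y⇝z₁ : OutsideQ y z₁
      y⇝z₁ = _ , y⇝z ++ʷ step z∈∁Q z~z₁ (here (start∈ W))
      z₁∉ : z₁ ∉ Config z
      z₁∉ z₁∈ with x∈p[y]≔inside⁻ z₁∈
      ... | inj₁ refl  = adj-irrefl z~z₁
      ... | inj₂ z₁∈Q∖c = ∁Q⇒∉Q∖c (start∈ W) z₁∈Q∖c
      move : LegalMove G (Config z) (Config z₁)
      move = z , z₁ , x∈p[x]≔inside Q∖c z , z₁∉ , z~z₁ ,
             cong (_[ z₁ ]≔ inside) (sym (p[x]≔inside[x]≔outside Q∖c z (∁Q⇒∉Q∖c z∈∁Q))) ,
             config-general-position y⇝z₁

    excursion : ∀ {x l} → WalkIn G (∁ Q) y x l → ∃ λ m → Σ (Run Q Q m) λ r → Visits r x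
    excursion {x} W = _ , run , visits-++ʳ (leave ∷ []) _ (visits-++ˡ outward _ (visits-end outward (x∈p[x]≔inside Q∖c x)))
      where
      y∈∁Q : y ∈ ∁ Q
      y∈∁Q = x∉p⇒x∈∁p y∉Q
      leave : LegalMove G Q (Config y)
      leave = c , y , c∈Q , y∉Q , c~y , refl , config-general-position (0 , here y∈∁Q)
      c∉ : c ∉ Config y
      c∉ c∈ with x∈p[y]≔inside⁻ c∈
      ... | inj₁ refl = y∉Q c∈Q
      ... | inj₂ c∈Q∖c = x∉p[x]≔outside Q c c∈Q∖c
      returned : Q ≡ (Config y [ y ]≔ outside) [ c ]≔ inside
      returned = sym (begin
        (Config y [ y ]≔ outside) [ c ]≔ inside
          ≡⟨ cong (_[ c ]≔ inside) (p[x]≔inside[x]≔outside Q∖c y (∁Q⇒∉Q∖c y∈∁Q)) ⟩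
        Q∖c [ c ]≔ inside
          ≡⟨ p[x]≔outside[x]≔inside Q c c∈Q ⟩
        Q ∎)
        where open ≡-Reasoning
      return : LegalMove G (Config y) Q
      return = y , c , x∈p[x]≔inside Q∖c y , c∉ , adj-sym c~y , returned , clique⇒general-position clique
      outward : Run (Config y) (Config x) _
      outward = walk-run W (0 , here y∈∁Q)
      run : Run Q Q _
      run = leave ∷ (outward ++ʳ (walk-run (reverse W) (_ , W) ++ʳ return ∷ []))

  last-exit : ∀ {u x k} → WalkIn G ⊤ u x k → x ∉ Q →
    ∃ (WalkIn G (∁ Q) u x) ⊎ ∃ λ c → ∃ λ y → c ∈ Q × Adj c y × ∃ (WalkIn G (∁ Q) y x)
  last-exit (here _) x∉Q = inj₁ (0 , here (x∉p⇒x∈∁p x∉Q))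
  last-exit (step {u} {w = u₁} _ u~u₁ W) x∉Q with last-exit W x∉Q
  ... | inj₂ exit = inj₂ exit
  ... | inj₁ (_ , W′) with u ∈? Q
  ...   | yes u∈Q = inj₂ (u , u₁ , u∈Q , u~u₁ , _ , W′)
  ...   | no  u∉Q = inj₁ (_ , step (x∉p⇒x∈∁p u∉Q) u~u₁ W′)

  ClosedRunVisiting : (Fin n → Set) → Set
  ClosedRunVisiting P = ∃ λ m → Σ (Run Q Q m) λ r → ∀ {x} → P x → Visits r x

  closed-run-visiting : ∀ x → ClosedRunVisiting (_≡ x)
  closed-run-visiting x with x ∈? Q
  ... | yes x∈Q = 0 , [] , λ { refl → visits-start [] x∈Q }
  ... | no  x∉Q with nonempty? Q
  ...   | no  Q-empty = ⊥-elim (1+n≰n (subst₂ _≤_ (∣⁅x⁆∣≡1 x) (trans (cong ∣_∣ (Empty-unique Q-empty)) (∣⊥∣≡0 n))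
                                   (maximum ⁅ x ⁆ singleton-clique)))
    where
    singleton-clique : IsClique G ⁅ x ⁆
    singleton-clique u v u∈ v∈ u≢v = ⊥-elim (u≢v (trans (x∈⁅y⁆⇒x≡y x u∈) (sym (x∈⁅y⁆⇒x≡y x v∈))))
  ...   | yes (q , q∈Q) with last-exit (proj₂ (proj₁ block-graph q x ∈⊤ ∈⊤)) x∉Q
  ...     | inj₁ (_ , W) = contradiction q∈Q (x∈∁p⇒x∉p (start∈ W))
  ...     | inj₂ (c , y , c∈Q , c~y , _ , W) =
    let m , r , visits = Excursion.excursion c∈Q c~y (x∈∁p⇒x∉p (start∈ W)) W in m , r , λ { refl → visits }

  closed-run-visiting-all : ∀ (xs : List (Fin n)) → ClosedRunVisiting (_∈ˡ xs)
  closed-run-visiting-all []       = 0 , [] , λ ()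
  closed-run-visiting-all (x ∷ xs) =
    let m , r , visits = closed-run-visiting x ; m′ , r′ , visits′ = closed-run-visiting-all xs
    in m + m′ , r ++ʳ r′ , λ { (here refl)   → visits-++ˡ r r′ (visits refl)
                              ; (there x∈xs) → visits-++ʳ r r′ (visits′ x∈xs) }

  maximum-clique-mobile : Mobile G Q
  maximum-clique-mobile =
    let _ , r , visits = closed-run-visiting-all (allFin n)
    in closed-run⇒mobile (clique⇒general-position clique) r λ x → visits (∈-allFin x)

module Locking (G : Graph) (block-graph : IsBlockGraph G) where
  open Graph G renaming (sym to adj-sym; irrefl to adj-irrefl)
  open Separation G
  open BlockGraph G block-graph

  private
    variable
      S T : Subset n
      c : Fin n

  SplitBy : Subset n → Fin n → Fin n → Set
  SplitBy S c x = ∃ λ y → ∃ λ z → y ∈ S × z ∈ S × y ≢ x × z ≢ x × Separates c y z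

  Locked : Subset n → Fin n → Set
  Locked S c = c ∉ S × ∀ {x} → x ∈ S → SplitBy S c x

  locked-preserved : GeneralPosition G S → Locked S c → LegalMove G S T → Locked T c
  locked-preserved {S} {c} gp (c∉S , split) (u , v , u∈S , v∉S , u~v , refl , gpT) = c∉S′ , split′
    where
    S′ : Subset n
    S′ = (S [ u ]≔ outside) [ v ]≔ inside
    ≢c : ∀ {t} → t ∈ S → t ≢ c
    ≢c t∈S = x∈p∧y∉p⇒x≢y t∈S c∉S
    ≢v : ∀ {t} → t ∈ S → t ≢ v
    ≢v t∈S = x∈p∧y∉p⇒x≢y t∈S v∉S
    stays : ∀ {t} → t ∈ S → t ≢ u → t ∈ S′
    stays t∈S t≢u = x∈p⇒x∈p[y]≔b inside (≢v t∈S) (x∈p⇒x∈p[y]≔b outside t≢u t∈S)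
    v≢c : v ≢ c
    v≢c refl with split u∈S
    ... | y , z , y∈S , z∈S , y≢u , z≢u , sep =
      separator-on-geodesic sep (gpT y v z (stays y∈S y≢u) (x∈p[x]≔inside _ v) (stays z∈S z≢u)
        (≢c y∈S) (≢c z∈S ∘ sym) λ { refl → sep (conn-refl (≢c y∈S)) })
    c∉S′ : c ∉ S′
    c∉S′ c∈S′ with x∈p[y]≔inside⁻ c∈S′
    ... | inj₁ c≡v = v≢c (sym c≡v)
    ... | inj₂ c∈ = c∉S (proj₂ (x∈p[y]≔outside⁻ c∈))
    relocate : ∀ {w t} → w ∈ S → t ∈ S → w ≢ t → ∃ λ w′ → w′ ∈ S′ × w′ ≢ t × ConnAvoiding c w w′
    relocate {w} w∈S t∈S w≢t with w ≟ u
    ... | yes refl = v , x∈p[x]≔inside _ v , ≢v t∈S ∘ sym , conn-adj (≢c u∈S) v≢c u~v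
    ... | no w≢u   = w , stays w∈S w≢u , w≢t , conn-refl (≢c w∈S)
    split′ : ∀ {t} → t ∈ S′ → SplitBy S′ c t
    split′ t∈S′ with x∈p[y]≔inside⁻ t∈S′
    ... | inj₁ refl with split u∈S
    ...   | y , z , y∈S , z∈S , y≢u , z≢u , sep =
      y , z , stays y∈S y≢u , stays z∈S z≢u , ≢v y∈S , ≢v z∈S , sep
    split′ t∈S′ | inj₂ t∈ with x∈p[y]≔outside⁻ t∈
    ... | _ , t∈S with split t∈S
    ...   | y , z , y∈S , z∈S , y≢t , z≢t , sep =
      let y′ , y′∈S′ , y′≢t , y⇝y′ = relocate y∈S t∈S y≢t
          z′ , z′∈S′ , z′≢t , z⇝z′ = relocate z∈S t∈S z≢t
      in y′ , z′ , y′∈S′ , z′∈S′ , y′≢t , z′≢t ,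
         λ y′⇝z′ → sep (conn-trans y⇝y′ (conn-trans y′⇝z′ (conn-sym z⇝z′)))

  mobile⇒unlocked : Mobile G S → ¬ Locked S c
  mobile⇒unlocked {S} {c} (gp , m , conf , conf₀ , legal , visits) locked =
    let i , i≤m , c∈ = visits c in proj₁ (proj₂ (invariant i i≤m)) c∈
    where
    invariant : ∀ i → i ≤ m → GeneralPosition G (conf i) × Locked (conf i) c
    invariant zero    _   = subst (λ X → GeneralPosition G X × Locked X c) (sym conf₀) (gp , locked)
    invariant (suc i) i<m =
      let gpᵢ , lockedᵢ = invariant i (≤-trans (n≤1+n i) i<m)
          move = legal i i<m
          _ , _ , _ , _ , _ , _ , gp′ = move
      in gp′ , locked-preserved gpᵢ lockedᵢ move

module Unlocked (G : Graph) (block-graph : IsBlockGraph G) {S : Subset (Graph.n G)} (gp : GeneralPosition G S)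
                (small-cliques : ∀ Q → IsClique G Q → ∣ Q ∣ < ∣ S ∣)
                (unlocked : ∀ c → ¬ Locking.Locked G block-graph S c) where
  open Graph G renaming (sym to adj-sym; irrefl to adj-irrefl)
  open Walks G
  open Separation G
  open Distance G
  open Blocks G
  open BlockGraph G block-graph
  open Cliques G
  open Locking G block-graph

  private
    variable
      a b c r w : Fin n
      d i : ℕ

  Clustered : Fin n → Fin n → Set
  Clustered c w = ∀ {y z} → y ∈ S → z ∈ S → y ≢ w → z ≢ w → ¬ Separates c y z

  ¬¬-clustered : c ∉ S → ¬ ¬ ∃ λ w → w ∈ S × Clustered c w
  ¬¬-clustered {c} c∉S none = ¬¬-Π-Fin split-or-clustered λ split → unlocked c (c∉S , λ {x} → split x)
    where
    split-or-clustered : ∀ x → ¬ ¬ (x ∈ S → SplitBy S c x)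
    split-or-clustered x = ¬¬-→ λ x∈S unsplit →
      none (x , x∈S , λ y∈S z∈S y≢x z≢x sep → unsplit (_ , _ , y∈S , z∈S , y≢x , z≢x , sep))

  clustered⇒separated-end : Clustered c w → a ∈ S → b ∈ S → Separates c a b → w ≡ a ⊎ w ≡ b
  clustered⇒separated-end {w = w} {a} {b} clustered a∈S b∈S sep with w ≟ a | w ≟ b
  ... | yes w≡a | _       = inj₁ w≡a
  ... | no _    | yes w≡b = inj₂ w≡b
  ... | no w≢a  | no w≢b  = contradiction sep (clustered a∈S b∈S (w≢a ∘ sym) (w≢b ∘ sym))

  module Isolation {x} (x∈S : x ∈ S) where

    Isolates : Fin n → Set
    Isolates c = c ∉ S × Clustered c x × (∀ {r} → r ∈ S → r ≢ x → Separates c x r)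

    clustered⇒isolates : c ∉ S → Clustered c x → r ∈ S → r ≢ x → Separates c x r → Isolates c
    clustered⇒isolates c∉S clustered r∈S r≢x sep = c∉S , clustered , λ r′∈S r′≢x x⇝r′ →
      clustered r′∈S r∈S r′≢x r≢x λ r′⇝r → sep (conn-trans x⇝r′ r′⇝r)

    isolates⇒closer : Isolates c → r ∈ S → r ≢ x → Dist G x c i → Dist G x r d → i < d
    isolates⇒closer (c∉S , _ , sep) r∈S r≢x Dxc Dxr with separator-splits-geodesic (sep r∈S r≢x) Dxr
    ... | i′ , j , refl , Dxc′ , Dcr rewrite dist-unique Dxc Dxc′ =
      m<m+n i′ (≢⇒dist>0 (x∈p∧y∉p⇒x≢y r∈S c∉S ∘ sym) Dcr)

    module AtCut {c i} (isolates : Isolates c) (Dxc : Dist G x c i) where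
      open Gate

      c∉S : c ∉ S
      c∉S = proj₁ isolates

      clustered : Clustered c x
      clustered = proj₁ (proj₂ isolates)

      x-separated : ∀ {t} → t ∈ S → t ≢ x → Separates c x t
      x-separated = proj₂ (proj₂ isolates)

      x-separated-from-gate : ∀ {t} (g : Gate c t) → t ∈ S → t ≢ x → Separates c x (vertex g)
      x-separated-from-gate g t∈S t≢x x⇝y = x-separated t∈S t≢x (conn-trans x⇝y (conn g))

      ¬¬-dist-to-gate : ∀ {t} (g : Gate c t) → t ∈ S → t ≢ x → ¬ ¬ Dist G x (vertex g) (suc i)
      ¬¬-dist-to-gate g t∈S t≢x = ¬¬-map (subst (Dist G x _) (+-comm i 1))
        (separator-dist (x-separated-from-gate g t∈S t≢x) Dxc (adj⇒dist1 (adjacent g)))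

      gate∉S : ∀ {t} (g : Gate c t) → t ∈ S → t ≢ x → vertex g ≢ t → vertex g ∉ S
      gate∉S g t∈S t≢x y≢t y∈S =
        ¬¬-dist-to-gate g t∈S t≢x λ Dxy → separator-dist (x-separated t∈S t≢x) Dxc (dist g) λ Dxt →
          gp _ _ _ x∈S y∈S t∈S x≢y y≢t (t≢x ∘ sym)
             (suc i , len g , Dxy , vertex-dist g , subst (Dist G x _) (+-suc i (len g)) Dxt)
        where
        x≢y : x ≢ vertex g
        x≢y x≡y = x-separated-from-gate g t∈S t≢x (subst (ConnAvoiding c x) x≡y (conn-refl (x∈p∧y∉p⇒x≢y x∈S c∉S)))

      module GateMap (gates : ∀ t → t ∈ S → t ≢ x → Gate c t) where

        -- φ sends x, and every vertex outside S, to c.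
        φ : Fin n → Fin n
        φ t with t ∈? S | t ≟ x
        ... | yes t∈S | no t≢x = vertex (gates t t∈S t≢x)
        ... | _       | _      = c

        φ-gate : ∀ {t} → t ∈ S → t ≢ x → Σ (Gate c t) λ g → vertex g ≡ φ t
        φ-gate {t} t∈S t≢x with t ∈? S | t ≟ x
        ... | yes t∈S′ | no t≢x′  = gates t t∈S′ t≢x′ , refl
        ... | no t∉S   | _        = contradiction t∈S t∉S
        ... | yes _    | yes t≡x  = contradiction t≡x t≢x

        φ-x : φ x ≡ c
        φ-x with x ∈? S | x ≟ x
        ... | yes _ | yes _  = refl
        ... | yes _ | no x≢x = contradiction refl x≢x
        ... | no _  | _      = refl

        φ≢c : ∀ {t} → t ∈ S → t ≢ x → φ t ≢ c
        φ≢c t∈S t≢x φt≡c = let g , y≡φt = φ-gate t∈S t≢x in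
          adj-irrefl (subst (Adj c) (trans y≡φt φt≡c) (adjacent g))

        SharedGate : Set
        SharedGate = ∃ λ r → ∃ λ r′ → r ∈ S × r′ ∈ S × r ≢ x × r′ ≢ x × r ≢ r′ × φ r ≡ φ r′

        Image : Subset n
        Image = ⟦ (λ w → any? λ t → t ∈? S ×-dec φ t ≟ w) ⟧

        φ≡c⇒≡x : ∀ {t} → t ∈ S → φ t ≡ c → t ≡ x
        φ≡c⇒≡x {t} t∈S φt≡c = decidable-stable (t ≟ x) λ t≢x → φ≢c t∈S t≢x φt≡c

        φ-injective : ¬ SharedGate → ∀ {u v} → u ∈ S → v ∈ S → φ u ≡ φ v → u ≡ v
        φ-injective unshared {u} {v} u∈S v∈S φu≡φv = decidable-stable (u ≟ v) λ u≢v →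
          unshared (u , v , u∈S , v∈S , ≢x u∈S v∈S φu≡φv u≢v , ≢x v∈S u∈S (sym φu≡φv) (u≢v ∘ sym) ,
                    u≢v , φu≡φv)
          where
          ≢x : ∀ {u v} → u ∈ S → v ∈ S → φ u ≡ φ v → u ≢ v → u ≢ x
          ≢x u∈S v∈S φu≡φv u≢v refl = u≢v (sym (φ≡c⇒≡x v∈S (trans (sym φu≡φv) φ-x)))

        φ≢c⇒≢x : ∀ {t} → φ t ≢ c → t ≢ x
        φ≢c⇒≢x φt≢c t≡x = φt≢c (trans (cong φ t≡x) φ-x)

        φ-adjacent : ∀ {t} → t ∈ S → φ t ≢ c → Adj c (φ t)
        φ-adjacent t∈S φt≢c = let g , y≡φt = φ-gate t∈S (φ≢c⇒≢x φt≢c) in subst (Adj c) y≡φt (adjacent g)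

        φ-conn : ∀ {t} → t ∈ S → φ t ≢ c → ConnAvoiding c (φ t) t
        φ-conn {t} t∈S φt≢c = let g , y≡φt = φ-gate t∈S (φ≢c⇒≢x φt≢c) in
          subst (λ y → ConnAvoiding c y t) y≡φt (conn g)

        φ-images-adjacent : ∀ {t₁ t₂} → t₁ ∈ S → t₂ ∈ S → φ t₁ ≢ φ t₂ → ¬ ¬ Adj (φ t₁) (φ t₂)
        φ-images-adjacent {t₁} {t₂} t₁∈S t₂∈S φ₁≢φ₂ with φ t₁ ≟ c | φ t₂ ≟ c
        ... | yes φ₁≡c | _        =
          pure (subst (λ w → Adj w (φ t₂)) (sym φ₁≡c) (φ-adjacent t₂∈S (φ₁≢φ₂ ∘ trans φ₁≡c ∘ sym)))
        ... | no φ₁≢c  | yes φ₂≡c = pure (subst (Adj (φ t₁)) (sym φ₂≡c) (adj-sym (φ-adjacent t₁∈S φ₁≢c)))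
        ... | no φ₁≢c  | no φ₂≢c  = do
          t₁⇝t₂ ← clustered t₁∈S t₂∈S (φ≢c⇒≢x φ₁≢c) (φ≢c⇒≢x φ₂≢c)
          avoiding-path⇒adj block-graph (adj-sym (φ-adjacent t₁∈S φ₁≢c)) (φ-adjacent t₂∈S φ₂≢c) φ₁≢φ₂
            (conn-trans (φ-conn t₁∈S φ₁≢c) (conn-trans t₁⇝t₂ (conn-sym (φ-conn t₂∈S φ₂≢c))))

        image-clique : ¬ ¬ IsClique G Image
        image-clique = ¬¬-clique pair
          where
          pair : ∀ w₁ w₂ → w₁ ∈ Image → w₂ ∈ Image → w₁ ≢ w₂ → ¬ ¬ Adj w₁ w₂
          pair w₁ w₂ w₁∈ w₂∈ with ∈⟦⟧⁻ _ w₁∈ | ∈⟦⟧⁻ _ w₂∈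
          ... | t₁ , t₁∈S , refl | t₂ , t₂∈S , refl = φ-images-adjacent t₁∈S t₂∈S

        -- Otherwise φ is injective on S and its image is a clique containing c.
        ¬¬-shared-gate : ¬ ¬ SharedGate
        ¬¬-shared-gate unshared = image-clique λ clique →
          <⇒≱ (small-cliques Image clique)
              (∣p∣≤∣q∣-injection S Image φ (φ-injective unshared) λ {t} t∈S → ∈⟦⟧⁺ _ (t , t∈S , refl))

        φ∉S : ∀ {t} → t ∈ S → t ≢ x → φ t ≢ t → φ t ∉ S
        φ∉S {t} t∈S t≢x φt≢t = let g , y≡φt = φ-gate t∈S t≢x in
          subst (_∉ S) y≡φt (gate∉S g t∈S t≢x (φt≢t ∘ trans (sym y≡φt)))

        φ-separates : ∀ {t} → t ∈ S → t ≢ x → φ t ∉ S → Separates (φ t) x t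
        φ-separates {t} t∈S t≢x φt∉S = let g , y≡φt = φ-gate t∈S t≢x in
          [ (λ y≡t → contradiction (subst (_∈ S) (trans (sym y≡t) y≡φt) t∈S) φt∉S)
          , (λ y-sep → sep-through (x-separated t∈S t≢x) (subst (λ y → Separates y c t) y≡φt y-sep))
          ]′ (separates g)

        φ-dist : ∀ {t} → t ∈ S → t ≢ x → ¬ ¬ Dist G x (φ t) (suc i)
        φ-dist t∈S t≢x = let g , y≡φt = φ-gate t∈S t≢x in
          ¬¬-map (subst (λ y → Dist G x y (suc i)) y≡φt) (¬¬-dist-to-gate g t∈S t≢x)

        shared-gate⇒next-cut : SharedGate → ¬ ¬ ∃ λ y → Isolates y × Dist G x y (suc i)
        shared-gate⇒next-cut (r , r′ , r∈S , r′∈S , r≢x , r′≢x , r≢r′ , φr≡φr′) = do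
          w , w∈S , clustered ← ¬¬-clustered y∉S
          let w≡x = the-isolated-end clustered
          Dxy ← φ-dist r∈S r≢x
          pure ( φ r
               , clustered⇒isolates y∉S (subst (Clustered (φ r)) w≡x clustered) r∈S r≢x (φ-separates r∈S r≢x y∉S)
               , Dxy)
          where
          y∉S : φ r ∉ S
          y∉S with φ r ≟ r
          ... | no φr≢r  = φ∉S r∈S r≢x φr≢r
          ... | yes φr≡r = subst (_∉ S) (sym φr≡φr′)
                             (φ∉S r′∈S r′≢x λ φr′≡r′ → r≢r′ (trans (sym φr≡r) (trans φr≡φr′ φr′≡r′)))
          the-isolated-end : ∀ {w} → Clustered (φ r) w → w ≡ x
          the-isolated-end clustered
            with clustered⇒separated-end clustered x∈S r∈S (φ-separates r∈S r≢x y∉S)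
               | clustered⇒separated-end clustered x∈S r′∈S
                   (subst (λ y → Separates y x _) (sym φr≡φr′) (φ-separates r′∈S r′≢x (subst (_∉ S) φr≡φr′ y∉S)))
          ... | inj₁ w≡x | _        = w≡x
          ... | inj₂ _   | inj₁ w≡x = w≡x
          ... | inj₂ w≡r | inj₂ w≡r′ = contradiction (trans (sym w≡r) w≡r′) r≢r′

      next-cut : ¬ ¬ ∃ λ y → Isolates y × Dist G x y (suc i)
      next-cut = do
        gates ← ¬¬-Π-Fin λ t → ¬¬-→ λ t∈S → ¬¬-→ λ _ → ¬¬-gate (x∈p∧y∉p⇒x≢y t∈S c∉S ∘ sym)
        shared ← GateMap.¬¬-shared-gate gates
        GateMap.shared-gate⇒next-cut gates shared

    -- Each step moves the cut vertex one edge away from x, while isolates⇒closer keeps it closer to x than r.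
    descent : ∀ f {r c i d} → r ∈ S → r ≢ x → Dist G x r d → Isolates c → Dist G x c i → d ≤ f + i → ⊥
    descent zero    r∈S r≢x Dxr isolates Dxc d≤i = <⇒≱ (isolates⇒closer isolates r∈S r≢x Dxc Dxr) d≤i
    descent (suc f) {i = i} {d} r∈S r≢x Dxr isolates Dxc d≤ = AtCut.next-cut isolates Dxc λ (y , isolates′ , Dxy) →
      descent f r∈S r≢x Dxr isolates′ Dxy (subst (d ≤_) (sym (+-suc f i)) d≤)

    isolates⇒⊥ : Isolates c → r ∈ S → r ≢ x → ⊥
    isolates⇒⊥ {c} {r} isolates r∈S r≢x =
      ¬¬-dist x r λ (d , Dxr) → ¬¬-dist x c λ (i , Dxc) → descent d r∈S r≢x Dxr isolates Dxc (m≤m+n d i)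

  separated-pair⇒⊥ : c ∉ S → a ∈ S → b ∈ S → Separates c a b → ⊥
  separated-pair⇒⊥ {c} {a} {b} c∉S a∈S b∈S sep = ¬¬-clustered c∉S λ (w , _ , clustered) →
    [ (λ { refl → cut-off a∈S b∈S b≢a clustered sep })
    , (λ { refl → cut-off b∈S a∈S (b≢a ∘ sym) clustered (sep-sym sep) })
    ]′ (clustered⇒separated-end clustered a∈S b∈S sep)
    where
    b≢a : b ≢ a
    b≢a refl = sep (conn-refl (x∈p∧y∉p⇒x≢y a∈S c∉S))
    cut-off : ∀ {x r} → x ∈ S → r ∈ S → r ≢ x → Clustered c x → Separates c x r → ⊥
    cut-off x∈S r∈S r≢x clustered sep =
      Isolation.isolates⇒⊥ x∈S (Isolation.clustered⇒isolates x∈S c∉S clustered r∈S r≢x sep) r∈S r≢x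

  non-adjacent-pair : ¬ ¬ ∃ λ a → ∃ λ b → a ∈ S × b ∈ S × a ≢ b × ¬ Adj a b
  non-adjacent-pair none =
    ¬¬-clique (λ u v u∈S v∈S u≢v ¬u~v → none (u , v , u∈S , v∈S , u≢v , ¬u~v)) λ clique →
      <-irrefl refl (small-cliques S clique)

  unlocked-large-set-impossible : ⊥
  unlocked-large-set-impossible = non-adjacent-pair λ (a , b , a∈S , b∈S , a≢b , ¬a~b) →
    ¬¬-dist a b (geodesic-from a∈S b∈S a≢b ¬a~b)
    where
    geodesic-from : a ∈ S → b ∈ S → a ≢ b → ¬ Adj a b → ¬ ∃ (Dist G a b)
    geodesic-from a∈S b∈S a≢b ¬a~b (_ , here _ , _) = a≢b refl
    geodesic-from {a} {b} a∈S b∈S a≢b ¬a~b (_ , step {w = c} _ a~c q , min) with c ≟ b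
    ... | yes refl = ¬a~b a~c
    ... | no c≢b   = separated-pair⇒⊥ c∉S a∈S b∈S sep
      where
      sep : Separates c a b
      sep = geodesic-successor-separates a~c q min c≢b
      c∉S : c ∉ S
      c∉S c∈S = separator-on-geodesic sep (gp a c b a∈S c∈S b∈S (λ { refl → adj-irrefl a~c }) c≢b a≢b)

theorem2p2 : (G : Graph) → IsBlockGraph G → (k : ℕ) → CliqueNumber G k → MobNumber G k
theorem2p2 G block-graph k ((Q , clique , ∣Q∣≡k) , maximum) =
  (Q , MaximumClique.maximum-clique-mobile G block-graph clique maximum-Q , ∣Q∣≡k) , mobile⇒≤k
  where
  maximum-Q : ∀ S → IsClique G S → ∣ S ∣ ≤ ∣ Q ∣
  maximum-Q S clique′ = subst (∣ S ∣ ≤_) (sym ∣Q∣≡k) (maximum S clique′)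
  mobile⇒≤k : ∀ S → Mobile G S → ∣ S ∣ ≤ k
  mobile⇒≤k S mobile = decidable-stable (∣ S ∣ ≤? k) λ ∣S∣≰k →
    Unlocked.unlocked-large-set-impossible G block-graph (proj₁ mobile)
      (λ Q′ clique′ → ≤-<-trans (maximum Q′ clique′) (≰⇒> ∣S∣≰k))
      (λ c → Locking.mobile⇒unlocked G block-graph mobile)
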